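{- Let $G$ be a factored graph and let $(u,v)$ be an edge of $G$. Then $\dim(u)=\dim(v)$.
   Context: All graphs are directed. Graph operations: Cartesian product $G\,\square\,H$ (vertex set $V(G)\times V(H)$, edge $((v_1,u_1),(v_2,u_2))$ iff $v_1=v_2$ and $(u_1,u_2)\in E(H)$, or $u_1=u_2$ and $(v_1,v_2)\in E(G)$), tensor product $G\times H$ (vertex set $V(G)\times V(H)$, edge iff $(v_1,v_2)\in E(G)$ and $(u_1,u_2)\in E(H)$), and union $G\cup H$ (vertex set $V(G)\cup V(H)$, edge set $E(G)\cup E(H)$). Vertices of products are flattened tuples, so products are associative. A factored graph $G=f(G_1,\dots,G_m)$ is given by a formula $f$ built from input graphs using these operations and parentheses. Its tree structure is defined recursively: a single graph gives a single leaf; if $f=H_1\circ\cdots\circ H_\ell$ for $\circ\in\{\cup,\square,\times\}$, the root is labelled $\circ$ with children the tree structures of $H_1,\dots,H_\ell$. A factored component $G_F$ of $G$ is a factored graph whose tree structure is obtained from that of $G$ by recursively replacing each internal union node with the subtree rooted at one of its children; $\dim(G_F)$ is the number of leaves of its tree. Any two factored components containing a common vertex have equal dimension, and the dimension $\dim(v)$ of a vertex $v$ is the dimension of any factored component containing it. -}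

module Defs where

open import Data.List using (List; []; _∷_; _++_)
open import Data.Nat using (ℕ; _+_)
open import Data.Product using (Σ; ∃; _×_; _,_)
open import Data.Sum using (_⊎_)
open import Relation.Binary.PropositionalEquality using (_≡_)

record BaseGraph (A : Set) : Set₁ where
  field
    V : A → Set
    E : A → A → Set
    E⊆V : ∀ {a b} → E a b → V a × V b

-- A directed graph whose vertices are flattened tuples (lists of atoms).
record Graph (A : Set) : Set₁ where
  field
    V : List A → Set
    E : List A → List A → Set

open Graph public

-- Factored formulas (= their tree structures); each operation is written
-- binary; n-ary operations are nestings of binary ones (products are
-- associative thanks to flattening, and union is associative).
data Formula (A : Set) : Set₁ where
  leaf  : BaseGraph A → Formula A
  _∪ᶠ_  : Formula A → Formula A → Formula A
  _□ᶠ_  : Formula A → Formula A → Formula A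
  _×ᶠ_  : Formula A → Formula A → Formula A

⟦_⟧ : {A : Set} → Formula A → Graph A
V ⟦ leaf g ⟧ xs = ∃ λ a → xs ≡ a ∷ [] × BaseGraph.V g a
E ⟦ leaf g ⟧ xs ys =
  ∃ λ a → ∃ λ b → xs ≡ a ∷ [] × ys ≡ b ∷ [] × BaseGraph.E g a b
V ⟦ f ∪ᶠ h ⟧ xs = V ⟦ f ⟧ xs ⊎ V ⟦ h ⟧ xs
E ⟦ f ∪ᶠ h ⟧ xs ys = E ⟦ f ⟧ xs ys ⊎ E ⟦ h ⟧ xs ys
V ⟦ f □ᶠ h ⟧ xs = ∃ λ v → ∃ λ u → xs ≡ v ++ u × V ⟦ f ⟧ v × V ⟦ h ⟧ u
E ⟦ f □ᶠ h ⟧ xs ys =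
  ∃ λ v₁ → ∃ λ u₁ → ∃ λ v₂ → ∃ λ u₂ →
    xs ≡ v₁ ++ u₁ × ys ≡ v₂ ++ u₂ ×
    ((v₁ ≡ v₂ × V ⟦ f ⟧ v₁ × E ⟦ h ⟧ u₁ u₂)
     ⊎ (u₁ ≡ u₂ × V ⟦ h ⟧ u₁ × E ⟦ f ⟧ v₁ v₂))
V ⟦ f ×ᶠ h ⟧ xs = ∃ λ v → ∃ λ u → xs ≡ v ++ u × V ⟦ f ⟧ v × V ⟦ h ⟧ u
E ⟦ f ×ᶠ h ⟧ xs ys =
  ∃ λ v₁ → ∃ λ u₁ → ∃ λ v₂ → ∃ λ u₂ →
    xs ≡ v₁ ++ u₁ × ys ≡ v₂ ++ u₂ × E ⟦ f ⟧ v₁ v₂ × E ⟦ h ⟧ u₁ u₂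

leaves : {A : Set} → Formula A → ℕ
leaves (leaf _) = 1
leaves (f ∪ᶠ h) = leaves f + leaves h
leaves (f □ᶠ h) = leaves f + leaves h
leaves (f ×ᶠ h) = leaves f + leaves h

data Component {A : Set} : Formula A → Formula A → Set₁ where
  c-leaf : ∀ {g} → Component (leaf g) (leaf g)
  c-∪ˡ   : ∀ {f h F} → Component f F → Component (f ∪ᶠ h) F
  c-∪ʳ   : ∀ {f h F} → Component h F → Component (f ∪ᶠ h) F
  c-□    : ∀ {f h F H} → Component f F → Component h H → Component (f □ᶠ h) (F □ᶠ H)
  c-×    : ∀ {f h F H} → Component f F → Component h H → Component (f ×ᶠ h) (F ×ᶠ H)

dimᶠ : {A : Set} → Formula A → ℕ
dimᶠ = leaves

-- v has dimension d in G = f: some factored component containing v has dim d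
-- (well defined by the standing fact recalled in the paper).
HasDim : {A : Set} → Formula A → List A → ℕ → Set₁
HasDim f v d = Σ _ λ F → Component f F × V ⟦ F ⟧ v × dimᶠ F ≡ d

{-# OPTIONS --safe #-}
module Submission where

open import Defs
open import Data.List using (List; _++_; length)
open import Data.List.Properties using (length-++)
open import Data.Nat using (ℕ; _+_)
open import Data.Product using (_,_)
open import Data.Sum using (inj₁; inj₂)
open import Relation.Binary.PropositionalEquality
  using (_≡_; refl; sym; trans; cong₂; module ≡-Reasoning)

-- The dimension of a vertex is just its length as a flattened tuple: a factored
-- component has no unions, so each of its vertices has one atom per leaf. Every
-- edge of a factored graph joins tuples of equal length, hence equal dimension.

length-++-cong : {A : Set} (v₁ u₁ v₂ u₂ : List A) →
  length v₁ ≡ length v₂ → length u₁ ≡ length u₂ →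
  length (v₁ ++ u₁) ≡ length (v₂ ++ u₂)
length-++-cong v₁ u₁ v₂ u₂ eqᵥ eqᵤ = begin
  length (v₁ ++ u₁)       ≡⟨ length-++ v₁ ⟩
  length v₁ + length u₁   ≡⟨ cong₂ _+_ eqᵥ eqᵤ ⟩
  length v₂ + length u₂   ≡⟨ sym (length-++ v₂) ⟩
  length (v₂ ++ u₂)       ∎
  where open ≡-Reasoning

component-vertex-length : {A : Set} {f F : Formula A} {xs : List A} →
  Component f F → V ⟦ F ⟧ xs → length xs ≡ dimᶠ F
component-vertex-length c-leaf (_ , refl , _) = refl
component-vertex-length (c-∪ˡ c) x = component-vertex-length c x
component-vertex-length (c-∪ʳ c) x = component-vertex-length c x
component-vertex-length (c-□ c₁ c₂) (v , _ , refl , x₁ , x₂) =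
  trans (length-++ v) (cong₂ _+_ (component-vertex-length c₁ x₁) (component-vertex-length c₂ x₂))
component-vertex-length (c-× c₁ c₂) (v , _ , refl , x₁ , x₂) =
  trans (length-++ v) (cong₂ _+_ (component-vertex-length c₁ x₁) (component-vertex-length c₂ x₂))

edge-preserves-length : {A : Set} (f : Formula A) {xs ys : List A} →
  E ⟦ f ⟧ xs ys → length xs ≡ length ys
edge-preserves-length (leaf _) (_ , _ , refl , refl , _) = refl
edge-preserves-length (f ∪ᶠ h) (inj₁ e) = edge-preserves-length f e
edge-preserves-length (f ∪ᶠ h) (inj₂ e) = edge-preserves-length h e
edge-preserves-length (f □ᶠ h) (v , u₁ , .v , u₂ , refl , refl , inj₁ (refl , _ , e)) =
  length-++-cong v u₁ v u₂ refl (edge-preserves-length h e)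
edge-preserves-length (f □ᶠ h) (v₁ , u , v₂ , .u , refl , refl , inj₂ (refl , _ , e)) =
  length-++-cong v₁ u v₂ u (edge-preserves-length f e) refl
edge-preserves-length (f ×ᶠ h) (v₁ , u₁ , v₂ , u₂ , refl , refl , e₁ , e₂) =
  length-++-cong v₁ u₁ v₂ u₂ (edge-preserves-length f e₁) (edge-preserves-length h e₂)

corollary2p10 : {A : Set} (f : Formula A) (u v : List A) → E ⟦ f ⟧ u v →
    (d₁ d₂ : ℕ) → HasDim f u d₁ → HasDim f v d₂ → d₁ ≡ d₂
corollary2p10 f u v e d₁ d₂ (F , cF , u∈F , refl) (H , cH , v∈H , refl) = begin
  dimᶠ F     ≡⟨ sym (component-vertex-length cF u∈F) ⟩
  length u   ≡⟨ edge-preserves-length f e ⟩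
  length v   ≡⟨ component-vertex-length cH v∈H ⟩
  dimᶠ H     ∎
  where open ≡-Reasoning
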